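{- Let $f$ be a positive Boolean function and let $S$ be any set of $k$ relevant variables of $f$. Then there exist at least $k+1$ extremal points of $f$ corresponding to $S$.
   Context: $B=\{0,1\}$; $\mathbf{x}\preceq\mathbf{y}$ means $(\mathbf{x})_i=1\Rightarrow(\mathbf{y})_i=1$ for all $i$. $f$ on $B^n$ is positive if $f(\mathbf{x})=1$ and $\mathbf{x}\preceq\mathbf{y}$ imply $f(\mathbf{y})=1$. Extremal points are the maximal false points (maximal zeros) and minimal true points (minimal ones) of $f$ under $\preceq$. A variable $x_k$ is relevant for $f$ if fixing $x_k=0$ and $x_k=1$ give different functions. A maximal zero $\mathbf{y}$ corresponds to variable $x_i$ if $(\mathbf{y})_i=0$; a minimal one $\mathbf{y}$ corresponds to $x_i$ if $(\mathbf{y})_i=1$. An extremal point corresponds to a set $S$ of variables if it corresponds to at least one variable in $S$. -}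

module Defs where

open import Data.Bool using (Bool; true; false)
open import Data.Nat using (ℕ)
open import Data.Fin using (Fin)
open import Data.Fin.Subset using (Subset; _∈_)
open import Data.Vec using (Vec; lookup; _[_]≔_)
open import Data.Product using (∃; _×_)
open import Data.Sum using (_⊎_)
open import Relation.Nullary using (¬_)
open import Relation.Binary.PropositionalEquality using (_≡_)

Point : ℕ → Set
Point n = Vec Bool n

BoolFun : ℕ → Set
BoolFun n = Point n → Bool

_⪯_ : ∀ {n} → Point n → Point n → Set
x ⪯ y = ∀ i → lookup x i ≡ true → lookup y i ≡ true

Positive : ∀ {n} → BoolFun n → Set
Positive f = ∀ x y → f x ≡ true → x ⪯ y → f y ≡ true

MaxZero : ∀ {n} → BoolFun n → Point n → Set
MaxZero f y = f y ≡ false × (∀ z → y ⪯ z → f z ≡ false → z ≡ y)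

MinOne : ∀ {n} → BoolFun n → Point n → Set
MinOne f y = f y ≡ true × (∀ z → z ⪯ y → f z ≡ true → z ≡ y)

Relevant : ∀ {n} → BoolFun n → Fin n → Set
Relevant f k = ¬ (∀ x → f (x [ k ]≔ false) ≡ f (x [ k ]≔ true))

ExtremalFor : ∀ {n} → BoolFun n → Subset n → Point n → Set
ExtremalFor f S y =
  (MaxZero f y × ∃ λ i → i ∈ S × lookup y i ≡ false)
  ⊎ (MinOne f y × ∃ λ i → i ∈ S × lookup y i ≡ true)

module Submission where

-- Induction on |S|. A relevant variable x_i lies in some minimal one and outside some maximal
-- zero, which settles |S| = 1. For the step, call x_i masked by x_j if fixing x_j = 0 makes x_i
-- irrelevant; this relation is transitive, so S has an element j such that every i ∈ S that j
-- masks also masks j. If j masks no other variable of S, all of S ∖ {j} stays relevant in f with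
-- x_j = 0, and the extremal points of that restriction map injectively to extremal points of f
-- for S, which a minimal one containing x_j then extends by one. Otherwise j has a mutual
-- masking partner in S, which forces all of S ∖ {j} to stay relevant with x_j = 1; that case is
-- the first one for the dual function x ↦ ¬ f (¬ x), which exchanges minimal ones and maximal
-- zeros.

open import Defs
open import Data.Bool using (Bool; true; false; not)
open import Data.Bool.Properties using (_≟_; not-involutive; not-injective)
open import Data.Empty using (⊥-elim)
open import Data.Fin using (Fin; zero; suc)
open import Data.Fin.Properties using (all?; any?) renaming (_≟_ to _≟ᶠ_)
open import Data.Fin.Subset using (Subset; _∈_; ∣_∣; ∁; Nonempty; inside; outside)
open import Data.Fin.Subset.Properties using (anySubset?; _∈?_)
open import Data.List using (List; []; _∷_; [_]; _++_; length; map; filter; allFin)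
open import Data.List.Properties using (length-map; map-id-local; map-∘)
open import Data.List.Membership.Propositional using () renaming (_∈_ to _∈ₗ_)
open import Data.List.Membership.Propositional.Properties
  using (∈-allFin; ∈-map⁺; ∈-++⁺ˡ; ∈-++⁺ʳ; ∈-filter⁺; ∈-filter⁻)
open import Data.List.Relation.Unary.All as All using (All; []; _∷_)
import Data.List.Relation.Unary.All.Properties as All
import Data.List.Relation.Unary.Any as Any
open import Data.List.Relation.Unary.AllPairs using ([]; _∷_)
open import Data.List.Relation.Unary.Unique.Propositional using (Unique)
import Data.List.Relation.Unary.Unique.Propositional.Properties as Unique
open import Data.Nat using (ℕ; zero; suc; _≤_; _≥_; s≤s; z≤n)
open import Data.Nat.Properties using (suc-injective)
open import Data.Product using (∃; _×_; _,_; proj₁)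
import Data.Product as Product
open import Data.Sum using (_⊎_; inj₁; inj₂)
open import Data.Vec using ([]; _∷_; lookup; _[_]≔_; here; there)
open import Data.Vec.Properties
  using ( lookup∘update; lookup∘update′; []≔-idempotent; []≔-lookup; lookup-map; map-[]≔
        ; []=⇒lookup; lookup⇒[]=)
open import Data.Vec.Relation.Binary.Pointwise.Extensional using (ext; Pointwise-≡⇒≡)
open import Function using (_∘_; id)
open import Relation.Binary.PropositionalEquality
  using (_≡_; _≢_; refl; sym; trans; cong; subst; module ≡-Reasoning)
open import Relation.Nullary using (¬_; Dec; yes; no; ¬?)
open import Relation.Nullary.Decidable using (_×-dec_; _→-dec_; decidable-stable; map′)

private variable
  n k : ℕ
  i j l : Fin n
  c : Bool
  x y z p q a b : Point n
  S : Subset n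

false≢true : false ≢ true
false≢true ()

contrapose : ∀ {u v : Bool} → (u ≡ true → v ≡ true) → v ≡ false → u ≡ false
contrapose {false} _ _ = refl
contrapose {true} u⇒v v≡false = trans (sym (u⇒v refl)) v≡false

not-contrapose : ∀ {u v : Bool} → (u ≡ true → v ≡ true) → not v ≡ true → not u ≡ true
not-contrapose {false} _ _ = refl
not-contrapose {true} {false} u⇒v _ = u⇒v refl

not≡true⇒≡false : ∀ {u : Bool} → not u ≡ true → u ≡ false
not≡true⇒≡false {false} _ = refl

not≡false⇒≡true : ∀ {u : Bool} → not u ≡ false → u ≡ true
not≡false⇒≡true {true} _ = refl

lookup-ext : (∀ i → lookup x i ≡ lookup y i) → x ≡ y
lookup-ext eq = Pointwise-≡⇒≡ (ext eq)

[]≔-id : lookup x j ≡ c → x [ j ]≔ c ≡ x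
[]≔-id {x = x} {j} refl = []≔-lookup x j

infix 4 _≈_except_

record _≈_except_ (p q : Point n) (i : Fin n) : Set where
  constructor agree
  field agrees : ∀ k → k ≢ i → lookup p k ≡ lookup q k
open _≈_except_

≈-[]≔ : (x : Point n) (i : Fin n) (c : Bool) → x ≈ x [ i ]≔ c except i
≈-[]≔ x i c = agree λ k k≢i → sym (lookup∘update′ k≢i x c)

[]≔-≈-[]≔ : (x : Point n) (i : Fin n) (u v : Bool) → x [ i ]≔ u ≈ x [ i ]≔ v except i
[]≔-≈-[]≔ x i u v = agree λ k k≢i → trans (lookup∘update′ k≢i x u) (sym (lookup∘update′ k≢i x v))

≈-cong-[]≔ : (m : Fin n) (c : Bool) → p ≈ q except i → p [ m ]≔ c ≈ q [ m ]≔ c except i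
≈-cong-[]≔ {p = p} {q} m c p≈q = agree agrees-[]≔
  where
  agrees-[]≔ : ∀ k → k ≢ _ → lookup (p [ m ]≔ c) k ≡ lookup (q [ m ]≔ c) k
  agrees-[]≔ k k≢i with k ≟ᶠ m
  ... | yes refl = trans (lookup∘update k p c) (sym (lookup∘update k q c))
  ... | no k≢m = trans (lookup∘update′ k≢m p c)
                       (trans (agrees p≈q k k≢i) (sym (lookup∘update′ k≢m q c)))

≈⇒≡[]≔ : p ≈ q except i → q ≡ p [ i ]≔ lookup q i
≈⇒≡[]≔ {p = p} {q} {i} p≈q = lookup-ext agrees-[]≔
  where
  agrees-[]≔ : ∀ k → lookup q k ≡ lookup (p [ i ]≔ lookup q i) k
  agrees-[]≔ k with k ≟ᶠ i
  ... | yes refl = sym (lookup∘update k p (lookup q k))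
  ... | no k≢i = trans (sym (agrees p≈q k k≢i)) (sym (lookup∘update′ k≢i p (lookup q i)))

⪯-refl : x ⪯ x
⪯-refl _ = id

⪯-trans : x ⪯ y → y ⪯ z → x ⪯ z
⪯-trans x⪯y y⪯z i = y⪯z i ∘ x⪯y i

⪯-antisym : x ⪯ y → y ⪯ x → x ≡ y
⪯-antisym x⪯y y⪯x = lookup-ext λ i → ⇒-antisym (x⪯y i) (y⪯x i)
  where
  ⇒-antisym : ∀ {u v : Bool} → (u ≡ true → v ≡ true) → (v ≡ true → u ≡ true) → u ≡ v
  ⇒-antisym {false} {false} _ _ = refl
  ⇒-antisym {false} {true} _ v⇒u = v⇒u refl
  ⇒-antisym {true} u⇒v _ = sym (u⇒v refl)

_⪯?_ : (x y : Point n) → Dec (x ⪯ y)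
x ⪯? y = all? λ i → (lookup x i ≟ true) →-dec (lookup y i ≟ true)

⪯-false : x ⪯ y → lookup y i ≡ false → lookup x i ≡ false
⪯-false {i = i} x⪯y = contrapose (x⪯y i)

[]≔-mono : (j : Fin n) (c : Bool) → x ⪯ y → (x [ j ]≔ c) ⪯ (y [ j ]≔ c)
[]≔-mono {x = x} {y} j c x⪯y i with i ≟ᶠ j
... | yes refl = trans (lookup∘update i y c) ∘ trans (sym (lookup∘update i x c))
... | no i≢j = λ e →
  trans (lookup∘update′ i≢j y c) (x⪯y i (trans (sym (lookup∘update′ i≢j x c)) e))

[]≔false-⪯ : (x : Point n) (j : Fin n) → (x [ j ]≔ false) ⪯ x
[]≔false-⪯ x j i e with i ≟ᶠ j
... | yes refl = ⊥-elim (false≢true (trans (sym (lookup∘update i x false)) e))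
... | no i≢j = trans (sym (lookup∘update′ i≢j x false)) e

⪯-[]≔true : (x : Point n) (j : Fin n) → x ⪯ (x [ j ]≔ true)
⪯-[]≔true x j i e with i ≟ᶠ j
... | yes refl = lookup∘update i x true
... | no i≢j = trans (lookup∘update′ i≢j x true) e

[]≔false-⪯⇒⪯-[]≔true : (x [ j ]≔ false) ⪯ y → x ⪯ (y [ j ]≔ true)
[]≔false-⪯⇒⪯-[]≔true {x = x} {j} {y} x₀⪯y i e with i ≟ᶠ j
... | yes refl = lookup∘update i y true
... | no i≢j =
  trans (lookup∘update′ i≢j y true) (x₀⪯y i (trans (lookup∘update′ i≢j x false) e))

⪯-[]≔true⇒⪯-[]≔false : x ⪯ (y [ j ]≔ true) → lookup x j ≡ false → x ⪯ (y [ j ]≔ false)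
⪯-[]≔true⇒⪯-[]≔false {x = x} {y} {j} x⪯y₁ xj i e with i ≟ᶠ j
... | yes refl = ⊥-elim (false≢true (trans (sym xj) e))
... | no i≢j =
  trans (lookup∘update′ i≢j y false) (trans (sym (lookup∘update′ i≢j y true)) (x⪯y₁ i e))

allPoints : ∀ n → List (Point n)
allPoints zero = [ [] ]
allPoints (suc n) = map (false ∷_) (allPoints n) ++ map (true ∷_) (allPoints n)

∈-allPoints : (x : Point n) → x ∈ₗ allPoints n
∈-allPoints [] = Any.here refl
∈-allPoints (false ∷ x) = ∈-++⁺ˡ (∈-map⁺ (false ∷_) (∈-allPoints x))
∈-allPoints (true ∷ x) = ∈-++⁺ʳ (map (false ∷_) (allPoints _)) (∈-map⁺ (true ∷_) (∈-allPoints x))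

module _ {P : Point n → Set} (P? : ∀ x → Dec (P x)) where

  ¬∃¬⇒∀ : ¬ (∃ λ x → ¬ P x) → ∀ x → P x
  ¬∃¬⇒∀ ¬∃¬ x = decidable-stable (P? x) (λ ¬p → ¬∃¬ (x , ¬p))

  ∀? : Dec (∀ x → P x)
  ∀? = map′ ¬∃¬⇒∀ (λ ∀P (x , ¬p) → ¬p (∀P x)) (¬? (anySubset? (¬? ∘ P?)))

  ¬∀⇒∃¬ : ¬ (∀ x → P x) → ∃ λ x → ¬ P x
  ¬∀⇒∃¬ ¬∀ = decidable-stable (anySubset? (¬? ∘ P?)) (¬∀ ∘ ¬∃¬⇒∀)

Minimal : {A : Set} → (A → A → Set) → List A → A → Set
Minimal R xs m = ∀ {y} → y ∈ₗ xs → R y m → R m y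

module _ {A : Set} {R : A → A → Set}
         (R? : ∀ u v → Dec (R u v)) (R-trans : ∀ {u v w} → R u v → R v w → R u w) where

  private
    minimal-∷ : ∀ u us → ∃ λ m → m ∈ₗ u ∷ us × Minimal R (u ∷ us) m
    minimal-∷ u [] = u , Any.here refl , λ { (Any.here refl) → id }
    minimal-∷ u (v ∷ vs) with minimal-∷ v vs
    ... | m , m∈ , m-min with R? u m | R? m u
    ... | yes uRm | no _ = u , Any.here refl , λ
      { (Any.here refl) → id
      ; (Any.there y∈) yRu → R-trans uRm (m-min y∈ (R-trans yRu uRm)) }
    ... | yes _ | yes mRu = m , Any.there m∈ , λ
      { (Any.here refl) _ → mRu
      ; (Any.there y∈) → m-min y∈ }
    ... | no ¬uRm | _ = m , Any.there m∈ , λ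
      { (Any.here refl) uRm → ⊥-elim (¬uRm uRm)
      ; (Any.there y∈) → m-min y∈ }

  minimal : ∀ {u us} → u ∈ₗ us → ∃ λ m → m ∈ₗ us × Minimal R us m
  minimal {us = u ∷ us} _ = minimal-∷ u us

∈-[]≔outside⁻ : i ∈ S [ j ]≔ outside → i ∈ S × i ≢ j
∈-[]≔outside⁻ {i = i} {S = S} {j} i∈ with i ≟ᶠ j
... | yes refl = ⊥-elim (false≢true (trans (sym (lookup∘update i S outside)) ([]=⇒lookup i∈)))
... | no i≢j = lookup⇒[]= i S (trans (sym (lookup∘update′ i≢j S outside)) ([]=⇒lookup i∈)) , i≢j

∣S∣≡1+∣S[j]≔outside∣ : j ∈ S → ∣ S ∣ ≡ suc ∣ S [ j ]≔ outside ∣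
∣S∣≡1+∣S[j]≔outside∣ {S = inside ∷ S} here = refl
∣S∣≡1+∣S[j]≔outside∣ {S = inside ∷ S} (there j∈S) = cong suc (∣S∣≡1+∣S[j]≔outside∣ j∈S)
∣S∣≡1+∣S[j]≔outside∣ {S = outside ∷ S} (there j∈S) = ∣S∣≡1+∣S[j]≔outside∣ j∈S

∣S[j]≔outside∣≡ : j ∈ S → ∣ S ∣ ≡ suc k → ∣ S [ j ]≔ outside ∣ ≡ k
∣S[j]≔outside∣≡ j∈S ∣S∣≡1+k = suc-injective (trans (sym (∣S∣≡1+∣S[j]≔outside∣ j∈S)) ∣S∣≡1+k)

∣S∣≡1+m⇒nonempty : ∀ {m} → ∣ S ∣ ≡ suc m → Nonempty S
∣S∣≡1+m⇒nonempty {S = inside ∷ S} _ = zero , here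
∣S∣≡1+m⇒nonempty {S = outside ∷ S} e = Product.map suc there (∣S∣≡1+m⇒nonempty e)

minOne-below : (f : BoolFun n) → f x ≡ true → ∃ λ a → MinOne f a × a ⪯ x
minOne-below {x = x} f fx =
  minOne (minimal _⪯?_ (λ {u v w} → ⪯-trans {x = u} {v} {w})
                   (∈-filter⁺ below? (∈-allPoints x) (fx , ⪯-refl {x = x})))
  where
  below? : ∀ p → Dec (f p ≡ true × p ⪯ x)
  below? p = (f p ≟ true) ×-dec (p ⪯? x)

  candidates : List (Point _)
  candidates = filter below? (allPoints _)

  minOne : (∃ λ a → a ∈ₗ candidates × Minimal _⪯_ candidates a) → ∃ λ a → MinOne f a × a ⪯ x
  minOne (a , a∈ , a-min) with ∈-filter⁻ below? {xs = allPoints _} a∈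
  ... | _ , fa , a⪯x =
    a , (fa , λ z z⪯a fz → ⪯-antisym {x = z} {a} z⪯a (a-min (candidate z⪯a fz) z⪯a)) , a⪯x
    where
    candidate : ∀ {z} → z ⪯ a → f z ≡ true → z ∈ₗ candidates
    candidate {z} z⪯a fz = ∈-filter⁺ below? (∈-allPoints z) (fz , ⪯-trans {x = z} {a} {x} z⪯a a⪯x)

Irrelevant : BoolFun n → Fin n → Set
Irrelevant f i = ∀ x → f (x [ i ]≔ false) ≡ f (x [ i ]≔ true)

irrelevant? : (f : BoolFun n) (i : Fin n) → Dec (Irrelevant f i)
irrelevant? f i = ∀? λ x → f (x [ i ]≔ false) ≟ f (x [ i ]≔ true)

_↾_≔_ : BoolFun n → Fin n → Bool → BoolFun n
(f ↾ j ≔ c) x = f (x [ j ]≔ c)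

module _ (f : BoolFun n) where

  irrelevant-[]≔ : Irrelevant f i → ∀ x c → f (x [ i ]≔ c) ≡ f x
  irrelevant-[]≔ {i} irr x c = trans (any-values c (lookup x i)) (cong f ([]≔-lookup x i))
    where
    any-values : ∀ u v → f (x [ i ]≔ u) ≡ f (x [ i ]≔ v)
    any-values false false = refl
    any-values false true = irr x
    any-values true false = sym (irr x)
    any-values true true = refl

  irrelevant-≈ : Irrelevant f i → p ≈ q except i → f p ≡ f q
  irrelevant-≈ {i} {p} {q} irr p≈q =
    trans (sym (irrelevant-[]≔ irr p (lookup q i))) (cong f (sym (≈⇒≡[]≔ p≈q)))

  irrelevant⇒minOne-false : Irrelevant f i → MinOne f a → lookup a i ≡ false
  irrelevant⇒minOne-false {i} {a} irr (fa , a-min) =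
    trans (cong (λ v → lookup v i) (sym a₀≡a)) (lookup∘update i a false)
    where
    a₀≡a : a [ i ]≔ false ≡ a
    a₀≡a = a-min _ ([]≔false-⪯ a i) (trans (irrelevant-[]≔ irr a false) fa)

  irrelevant⇒maxZero-true : Irrelevant f i → MaxZero f b → lookup b i ≡ true
  irrelevant⇒maxZero-true {i} {b} irr (fb , b-max) =
    trans (cong (λ v → lookup v i) (sym b₁≡b)) (lookup∘update i b true)
    where
    b₁≡b : b [ i ]≔ true ≡ b
    b₁≡b = b-max _ (⪯-[]≔true b i) (trans (irrelevant-[]≔ irr b true) fb)

module _ (f : BoolFun n) where

  ↾-irrelevant : (j : Fin n) (c : Bool) → Irrelevant (f ↾ j ≔ c) j
  ↾-irrelevant j c x = cong f (trans ([]≔-idempotent x j) (sym ([]≔-idempotent x j)))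

  ↾-agrees : lookup x j ≡ c → (f ↾ j ≔ c) x ≡ f x
  ↾-agrees = cong f ∘ []≔-id

  ↾-positive : Positive f → (j : Fin n) (c : Bool) → Positive (f ↾ j ≔ c)
  ↾-positive pos j c x y fx x⪯y = pos _ _ fx ([]≔-mono {x = x} {y} j c x⪯y)

  ↾-irrelevant-≈ : Irrelevant (f ↾ j ≔ c) i → i ≢ j → lookup p j ≡ c → p ≈ q except i → f p ≡ f q
  ↾-irrelevant-≈ {j} {c} {p = p} {q} irr i≢j pj p≈q = begin
    f p             ≡⟨ sym (↾-agrees pj) ⟩
    (f ↾ j ≔ c) p   ≡⟨ irrelevant-≈ (f ↾ j ≔ c) irr p≈q ⟩
    (f ↾ j ≔ c) q   ≡⟨ ↾-agrees (trans (sym (agrees p≈q j (i≢j ∘ sym))) pj) ⟩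
    f q             ∎
    where open ≡-Reasoning

  MaskedBy : Fin n → Fin n → Set
  MaskedBy i j = Irrelevant (f ↾ j ≔ false) i

  maskedBy? : ∀ i j → Dec (MaskedBy i j)
  maskedBy? i j = irrelevant? (f ↾ j ≔ false) i

  maskedBy-trans : MaskedBy i j → MaskedBy j l → MaskedBy i l
  maskedBy-trans {i} {j} {l} i◁j j◁l with i ≟ᶠ j | j ≟ᶠ l
  ... | yes refl | _ = j◁l
  ... | no _ | yes refl = i◁j
  ... | no i≢j | no j≢l = i◁l
    where
    i◁l : MaskedBy i l
    i◁l x = begin
      f (x₀ [ l ]≔ false)              ≡⟨ ↾-irrelevant-≈ j◁l j≢l x₀ₗ (≈-[]≔ _ j false) ⟩
      f (x₀ [ l ]≔ false [ j ]≔ false) ≡⟨ ↾-irrelevant-≈ i◁j i≢j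
                                           (lookup∘update j (x₀ [ l ]≔ false) false)
                                           (≈-cong-[]≔ j false (≈-cong-[]≔ l false
                                             ([]≔-≈-[]≔ x i false true))) ⟩
      f (x₁ [ l ]≔ false [ j ]≔ false) ≡⟨ ↾-irrelevant-≈ j◁l j≢l x₁ₗ (≈-[]≔ _ j false) ⟨
      f (x₁ [ l ]≔ false)              ∎
      where
      open ≡-Reasoning
      x₀ x₁ : Point n
      x₀ = x [ i ]≔ false
      x₁ = x [ i ]≔ true
      x₀ₗ : lookup (x₀ [ l ]≔ false) l ≡ false
      x₀ₗ = lookup∘update l x₀ false
      x₁ₗ : lookup (x₁ [ l ]≔ false) l ≡ false
      x₁ₗ = lookup∘update l x₁ false

  -- On points with x_j = 0, the update (x_i, x_j) := (0, 1) leaves f unchanged, so there any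
  -- dependence on x_l is a dependence of f ↾ j ≔ true on x_l.
  mutually-masked⇒irrelevant : i ≢ j → MaskedBy i j → MaskedBy j i →
                               l ≢ j → Irrelevant (f ↾ j ≔ true) l → Irrelevant f l
  mutually-masked⇒irrelevant {i} {j} {l} i≢j i◁j j◁i l≢j irr x with lookup x j in xj
  ... | true = ↾-irrelevant-≈ irr l≢j (trans (lookup∘update′ (l≢j ∘ sym) x false) xj)
                 ([]≔-≈-[]≔ x l false true)
  ... | false = begin
    f x₀                                 ≡⟨ swap x₀ (xₗj false) ⟩
    f (x₀ [ i ]≔ false [ j ]≔ true)      ≡⟨ ↾-irrelevant-≈ irr l≢j
                                              (lookup∘update j (x₀ [ i ]≔ false) true)
                                              (≈-cong-[]≔ j true (≈-cong-[]≔ i false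
                                                ([]≔-≈-[]≔ x l false true))) ⟩
    f (x₁ [ i ]≔ false [ j ]≔ true)      ≡⟨ swap x₁ (xₗj true) ⟨
    f x₁                                 ∎
    where
    open ≡-Reasoning
    x₀ x₁ : Point n
    x₀ = x [ l ]≔ false
    x₁ = x [ l ]≔ true

    xₗj : ∀ c → lookup (x [ l ]≔ c) j ≡ false
    xₗj c = trans (lookup∘update′ (l≢j ∘ sym) x c) xj

    swap : ∀ z → lookup z j ≡ false → f z ≡ f (z [ i ]≔ false [ j ]≔ true)
    swap z zj = trans (↾-irrelevant-≈ i◁j i≢j zj (≈-[]≔ z i false))
                      (↾-irrelevant-≈ j◁i (i≢j ∘ sym) (lookup∘update i z false) (≈-[]≔ _ j true))

  pivot : Nonempty S → (∀ i → i ∈ S → Relevant f i) →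
          ∃ λ j → j ∈ S × ((∀ i → i ∈ S [ j ]≔ outside → Relevant (f ↾ j ≔ false) i)
                          ⊎ (∀ i → i ∈ S [ j ]≔ outside → Relevant (f ↾ j ≔ true) i))
  pivot {S = S} (s , s∈S) rel
    with minimal maskedBy? maskedBy-trans (∈-filter⁺ (_∈? S) (∈-allFin s) s∈S)
  ... | j , j∈ , j-min with ∈-filter⁻ (_∈? S) {xs = allFin _} j∈
  ... | _ , j∈S with any? (λ i → (i ∈? S) ×-dec ¬? (i ≟ᶠ j) ×-dec maskedBy? i j)
  ... | no ¬masked = j , j∈S , inj₁ λ i i∈S′ i◁j →
          let i∈S , i≢j = ∈-[]≔outside⁻ i∈S′ in ¬masked (i , i∈S , i≢j , i◁j)
  ... | yes (i , i∈S , i≢j , i◁j) = j , j∈S , inj₂ λ l l∈S′ irr →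
          let l∈S , l≢j = ∈-[]≔outside⁻ l∈S′
              j◁i = j-min (∈-filter⁺ (_∈? S) (∈-allFin i) i∈S) i◁j
          in rel l l∈S (mutually-masked⇒irrelevant i≢j i◁j j◁i l≢j irr)

  relevant-witness : Positive f → Relevant f j →
                     ∃ λ x → f (x [ j ]≔ false) ≡ false × f (x [ j ]≔ true) ≡ true
  relevant-witness {j} pos rel
    with ¬∀⇒∃¬ (λ x → f (x [ j ]≔ false) ≟ f (x [ j ]≔ true)) rel
  ... | x , f₀≢f₁ with f (x [ j ]≔ false) in f₀ | f (x [ j ]≔ true) in f₁
  ... | false | true = x , f₀ , f₁
  ... | false | false = ⊥-elim (f₀≢f₁ refl)
  ... | true | true = ⊥-elim (f₀≢f₁ refl)
  ... | true | false = ⊥-elim (false≢true (trans (sym f₁) (pos _ _ f₀ x₀⪯x₁)))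
    where
    x₀⪯x₁ : (x [ j ]≔ false) ⪯ (x [ j ]≔ true)
    x₀⪯x₁ = ⪯-trans {x = x [ j ]≔ false} {x} {x [ j ]≔ true} ([]≔false-⪯ x j) (⪯-[]≔true x j)

  relevant⇒minOne : Positive f → Relevant f j → ∃ λ a → MinOne f a × lookup a j ≡ true
  relevant⇒minOne {j} pos rel with relevant-witness pos rel
  ... | x , f₀ , f₁ with minOne-below f f₁
  ... | a , a-min , a⪯x₁ with lookup a j in aj
  ... | true = a , a-min , aj
  ... | false = ⊥-elim (false≢true (trans (sym f₀) (pos a _ (proj₁ a-min) a⪯x₀)))
    where
    a⪯x₀ : a ⪯ (x [ j ]≔ false)
    a⪯x₀ = ⪯-[]≔true⇒⪯-[]≔false {x = a} {x} a⪯x₁ aj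

ExtremalsAtLeast : ℕ → BoolFun n → Subset n → Set
ExtremalsAtLeast {n} k f S =
  ∃ λ (ps : List (Point n)) → Unique ps × length ps ≥ k × All (ExtremalFor f S) ps

unique-map-retraction : ∀ {A B : Set} {xs : List A} (h : A → B) (r : B → A) →
                        All (λ x → r (h x) ≡ x) xs → Unique xs → Unique (map h xs)
unique-map-retraction {xs = xs} h r rh≡id unique =
  Unique.map⁻ {f = r} (subst Unique (trans (sym (map-id-local rh≡id)) (map-∘ xs)) unique)

module Extension (f : BoolFun n) (pos : Positive f) (j : Fin n) where

  g : BoolFun n
  g = f ↾ j ≔ false

  -- Every extremal point y of g is sent to an extremal point of f by resetting x_j to not (f y);
  -- y is recovered from the image as x_j is always not (g y) on extremal points of g.
  lift : Point n → Point n
  lift y = y [ j ]≔ not (f y)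

  lower : Point n → Point n
  lower y = y [ j ]≔ not (g y)

  minOne-j : MinOne g a → lookup a j ≡ false
  minOne-j = irrelevant⇒minOne-false g (↾-irrelevant f j false)

  maxZero-j : MaxZero g b → lookup b j ≡ true
  maxZero-j = irrelevant⇒maxZero-true g (↾-irrelevant f j false)

  lift-minOne : MinOne g a → lift a ≡ a
  lift-minOne {a} a-min@(ga , _) =
    trans (cong (λ c → a [ j ]≔ not c) (trans (sym (↾-agrees f (minOne-j a-min))) ga))
          ([]≔-id (minOne-j a-min))

  minOne-lift : MinOne g a → MinOne f (lift a)
  minOne-lift {a} a-min@(ga , a-minimal) rewrite lift-minOne a-min =
    trans (sym (↾-agrees f (minOne-j a-min))) ga ,
    λ z z⪯a fz → a-minimal z z⪯a (trans (↾-agrees f (⪯-false {x = z} {a} z⪯a (minOne-j a-min))) fz)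

  maxZero-lift-false : MaxZero g b → f b ≡ false → MaxZero f b
  maxZero-lift-false (gb , b-maximal) fb =
    fb , λ z b⪯z fz → b-maximal z b⪯z (contrapose (λ gz → pos _ z gz ([]≔false-⪯ z j)) fz)

  maxZero-lift-true : MaxZero g b → f b ≡ true → MaxZero f (b [ j ]≔ false)
  maxZero-lift-true {b} (gb , b-maximal) fb = gb , maximality
    where
    maximality : ∀ z → (b [ j ]≔ false) ⪯ z → f z ≡ false → z ≡ b [ j ]≔ false
    maximality z b₀⪯z fz with lookup z j in zj
    ... | true = ⊥-elim (false≢true (trans (sym fz) (trans (cong f (sym ([]≔-id zj))) f-z₁)))
      where f-z₁ = pos b _ fb ([]≔false-⪯⇒⪯-[]≔true {x = b} {j} {z} b₀⪯z)
    ... | false = begin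
      z                            ≡⟨ []≔-id zj ⟨
      z [ j ]≔ false               ≡⟨ []≔-idempotent z j ⟨
      z [ j ]≔ true [ j ]≔ false   ≡⟨ cong (_[ j ]≔ false) z₁≡b ⟩
      b [ j ]≔ false               ∎
      where
      open ≡-Reasoning
      z₁≡b : z [ j ]≔ true ≡ b
      z₁≡b = b-maximal _ ([]≔false-⪯⇒⪯-[]≔true {x = b} {j} {z} b₀⪯z)
               (trans (irrelevant-[]≔ g (↾-irrelevant f j false) z true) (trans (↾-agrees f zj) fz))

  maxZero-lift : MaxZero g b → MaxZero f (b [ j ]≔ not (f b))
  maxZero-lift {b} b-max with f b in fb
  ... | true = maxZero-lift-true b-max fb
  ... | false = subst (MaxZero f) (sym ([]≔-id (maxZero-j b-max))) (maxZero-lift-false b-max fb)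

  module _ (S : Subset n) where

    extremal-j : ExtremalFor g (S [ j ]≔ outside) y → lookup y j ≡ not (g y)
    extremal-j (inj₁ (b-max , _)) = trans (maxZero-j b-max) (cong not (sym (proj₁ b-max)))
    extremal-j (inj₂ (a-min , _)) = trans (minOne-j a-min) (cong not (sym (proj₁ a-min)))

    lower-lift : ExtremalFor g (S [ j ]≔ outside) y → lower (lift y) ≡ y
    lower-lift {y} y-ext = begin
      lift y [ j ]≔ not (g (lift y))   ≡⟨ cong (λ c → lift y [ j ]≔ not c)
                                            (irrelevant-[]≔ g (↾-irrelevant f j false) y _) ⟩
      lift y [ j ]≔ not (g y)          ≡⟨ []≔-idempotent y j ⟩
      y [ j ]≔ not (g y)               ≡⟨ []≔-id (extremal-j y-ext) ⟩
      y                                ∎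
      where open ≡-Reasoning

    shift : (∃ λ i → i ∈ S [ j ]≔ outside × lookup y i ≡ c) → ∃ λ i → i ∈ S × lookup (lift y) i ≡ c
    shift {y} (i , i∈S′ , yi) with ∈-[]≔outside⁻ i∈S′
    ... | i∈S , i≢j = i , i∈S , trans (lookup∘update′ i≢j y _) yi

    lift-extremal : ExtremalFor g (S [ j ]≔ outside) y → ExtremalFor f S (lift y)
    lift-extremal {y} (inj₁ (b-max , witness)) = inj₁ (maxZero-lift b-max , shift {y = y} witness)
    lift-extremal {y} (inj₂ (a-min , witness)) = inj₂ (minOne-lift a-min , shift {y = y} witness)

    fresh : MinOne f a → lookup a j ≡ true → ExtremalFor g (S [ j ]≔ outside) y → a ≢ lift y
    fresh a-min aj (inj₁ (b-max , _)) a≡ =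
      false≢true (trans (sym (proj₁ (maxZero-lift b-max))) (trans (cong f (sym a≡)) (proj₁ a-min)))
    fresh a-min aj (inj₂ (y-min , _)) a≡ =
      false≢true (trans (sym (minOne-j y-min))
                        (trans (cong (λ v → lookup v j) (sym (trans a≡ (lift-minOne y-min)))) aj))

    extend : j ∈ S → Relevant f j →
             ExtremalsAtLeast k g (S [ j ]≔ outside) → ExtremalsAtLeast (suc k) f S
    extend j∈S rel (ps , unique , k≤∣ps∣ , extremal) with relevant⇒minOne f pos rel
    ... | a , a-min , aj =
        a ∷ map lift ps
      , All.map⁺ (All.map (fresh a-min aj) extremal)
        ∷ unique-map-retraction lift lower (All.map lower-lift extremal) unique
      , s≤s (subst (_ ≤_) (sym (length-map lift ps)) k≤∣ps∣)
      , inj₂ (a-min , j , j∈S , aj) ∷ All.map⁺ (All.map lift-extremal extremal)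

dual : BoolFun n → BoolFun n
dual f x = not (f (∁ x))

lookup-∁ : (x : Point n) (i : Fin n) → lookup (∁ x) i ≡ not (lookup x i)
lookup-∁ x i = lookup-map i not x

∁-involutive : ∁ (∁ x) ≡ x
∁-involutive {x = x} =
  lookup-ext λ i → trans (lookup-∁ (∁ x) i) (trans (cong not (lookup-∁ x i)) (not-involutive _))

∁-injective : ∁ x ≡ ∁ y → x ≡ y
∁-injective ∁x≡∁y = trans (sym ∁-involutive) (trans (cong ∁ ∁x≡∁y) ∁-involutive)

∁-antitone : x ⪯ y → ∁ y ⪯ ∁ x
∁-antitone {x = x} {y} x⪯y i e =
  trans (lookup-∁ x i) (not-contrapose (x⪯y i) (trans (sym (lookup-∁ y i)) e))

∁-[]≔ : (x : Point n) (i : Fin n) (c : Bool) → ∁ (x [ i ]≔ c) ≡ ∁ x [ i ]≔ not c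
∁-[]≔ x i c = map-[]≔ not x i

module _ (f : BoolFun n) where

  dual-positive : Positive f → Positive (dual f)
  dual-positive pos x y dfx x⪯y =
    not-contrapose (λ fy → pos (∁ y) (∁ x) fy (∁-antitone {x = x} {y} x⪯y)) dfx

  minOne-dual : MinOne (dual f) a → MaxZero f (∁ a)
  minOne-dual {a} (dfa , a-minimal) = not≡true⇒≡false dfa , maximality
    where
    maximality : ∀ z → ∁ a ⪯ z → f z ≡ false → z ≡ ∁ a
    maximality z ∁a⪯z fz = trans (sym ∁-involutive) (cong ∁ (a-minimal (∁ z) ∁z⪯a df∁z))
      where
      ∁z⪯a : ∁ z ⪯ a
      ∁z⪯a = subst (∁ z ⪯_) (∁-involutive {x = a}) (∁-antitone {x = ∁ a} {z} ∁a⪯z)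
      df∁z : dual f (∁ z) ≡ true
      df∁z = trans (cong (not ∘ f) ∁-involutive) (cong not fz)

  maxZero-dual : MaxZero (dual f) b → MinOne f (∁ b)
  maxZero-dual {b} (dfb , b-maximal) = not≡false⇒≡true dfb , minimality
    where
    minimality : ∀ z → z ⪯ ∁ b → f z ≡ true → z ≡ ∁ b
    minimality z z⪯∁b fz = trans (sym ∁-involutive) (cong ∁ (b-maximal (∁ z) b⪯∁z df∁z))
      where
      b⪯∁z : b ⪯ ∁ z
      b⪯∁z = subst (_⪯ ∁ z) (∁-involutive {x = b}) (∁-antitone {x = z} {∁ b} z⪯∁b)
      df∁z : dual f (∁ z) ≡ false
      df∁z = trans (cong (not ∘ f) ∁-involutive) (cong not fz)

  relevant-dual : Relevant f i → Relevant (dual f) i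
  relevant-dual {i} rel irr = rel λ x → sym (not-injective (begin
    not (f (x [ i ]≔ true))               ≡⟨ cong (not ∘ f) (∁∁-[]≔ x false) ⟨
    not (f (∁ (∁ x [ i ]≔ false)))        ≡⟨ irr (∁ x) ⟩
    not (f (∁ (∁ x [ i ]≔ true)))         ≡⟨ cong (not ∘ f) (∁∁-[]≔ x true) ⟩
    not (f (x [ i ]≔ false))              ∎))
    where
    open ≡-Reasoning
    ∁∁-[]≔ : ∀ x c → ∁ (∁ x [ i ]≔ c) ≡ x [ i ]≔ not c
    ∁∁-[]≔ x c = trans (∁-[]≔ (∁ x) i c) (cong (_[ i ]≔ not c) ∁-involutive)

  dual-↾ : ∀ (j : Fin n) c x → dual (f ↾ j ≔ c) x ≡ (dual f ↾ j ≔ not c) x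
  dual-↾ j c x =
    cong (not ∘ f) (sym (trans (∁-[]≔ x j (not c)) (cong (∁ x [ j ]≔_) (not-involutive c))))

  dual-extremal : ExtremalFor (dual f) S y → ExtremalFor f S (∁ y)
  dual-extremal {y = y} (inj₁ (b-max , i , i∈S , yi)) =
    inj₂ (maxZero-dual b-max , i , i∈S , trans (lookup-∁ y i) (cong not yi))
  dual-extremal {y = y} (inj₂ (a-min , i , i∈S , yi)) =
    inj₁ (minOne-dual a-min , i , i∈S , trans (lookup-∁ y i) (cong not yi))

  dual-extremals : ExtremalsAtLeast k (dual f) S → ExtremalsAtLeast k f S
  dual-extremals (ps , unique , k≤∣ps∣ , extremal) =
      map ∁ ps
    , Unique.map⁺ ∁-injective unique
    , subst (_ ≤_) (sym (length-map ∁ ps)) k≤∣ps∣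
    , All.map⁺ (All.map dual-extremal extremal)

relevant-↾-dual : (f : BoolFun n) → Relevant (f ↾ j ≔ true) i → Relevant (dual f ↾ j ≔ false) i
relevant-↾-dual {j = j} f rel irr =
  relevant-dual (f ↾ j ≔ true) rel λ x →
    trans (dual-↾ f j true _) (trans (irr x) (sym (dual-↾ f j true _)))

relevant⇒maxZero : (f : BoolFun n) → Positive f → Relevant f j →
                   ∃ λ b → MaxZero f b × lookup b j ≡ false
relevant⇒maxZero {j = j} f pos rel =
  let a , a-min , aj = relevant⇒minOne (dual f) (dual-positive f pos) (relevant-dual f rel)
  in ∁ a , minOne-dual f a-min , trans (lookup-∁ a j) (cong not aj)

two-extremals : (f : BoolFun n) → Positive f → i ∈ S → Relevant f i → ExtremalsAtLeast 2 f S
two-extremals {i = i} f pos i∈S rel =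
  let a , a-min , ai = relevant⇒minOne f pos rel
      b , b-max , bi = relevant⇒maxZero f pos rel
      a≢b : a ≢ b
      a≢b a≡b = false≢true (trans (sym (proj₁ b-max)) (trans (cong f (sym a≡b)) (proj₁ a-min)))
  in  a ∷ b ∷ []
    , (a≢b ∷ []) ∷ [] ∷ []
    , s≤s (s≤s z≤n)
    , inj₂ (a-min , i , i∈S , ai) ∷ inj₁ (b-max , i , i∈S , bi) ∷ []

open Extension using (extend)

extremals : ∀ m (f : BoolFun n) → Positive f → ∣ S ∣ ≡ suc m → (∀ i → i ∈ S → Relevant f i) →
            ExtremalsAtLeast (suc (suc m)) f S
extremals zero f pos ∣S∣≡1 rel with ∣S∣≡1+m⇒nonempty ∣S∣≡1
... | i , i∈S = two-extremals f pos i∈S (rel i i∈S)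
extremals {S = S} (suc m) f pos ∣S∣≡2+m rel with pivot f (∣S∣≡1+m⇒nonempty ∣S∣≡2+m) rel
... | j , j∈S , inj₁ rel₀ =
  extend f pos j S j∈S (rel j j∈S)
    (extremals m (f ↾ j ≔ false) (↾-positive f pos j false) (∣S[j]≔outside∣≡ j∈S ∣S∣≡2+m) rel₀)
... | j , j∈S , inj₂ rel₁ =
  dual-extremals f (extend (dual f) (dual-positive f pos) j S j∈S (relevant-dual f (rel j j∈S))
    (extremals m (dual f ↾ j ≔ false) (↾-positive (dual f) (dual-positive f pos) j false)
      (∣S[j]≔outside∣≡ j∈S ∣S∣≡2+m)
      (λ i i∈S′ → relevant-↾-dual f (rel₁ i i∈S′))))

lemma1 : (n : ℕ) (f : BoolFun n) → Positive f →
         (S : Subset n) → 1 ≤ ∣ S ∣ → (∀ i → i ∈ S → Relevant f i) →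
         ∃ λ (ps : List (Point n)) →
           Unique ps × length ps ≥ suc ∣ S ∣ × All (ExtremalFor f S) ps
lemma1 n f pos S 1≤∣S∣ rel with ∣ S ∣ in ∣S∣≡ | 1≤∣S∣
... | zero | ()
... | suc m | _ = extremals m f pos ∣S∣≡ rel
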